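{- Let $T$ be a complete lattice. There is an order embedding from $\mathcal{P}(\omega)$ into $T$ if and only if there are sequences $(x_n)_{n\in\omega}$ and $(y_n)_{n\in\omega}$ of elements of $T$ such that: (i) $x_0>x_1>x_2>\cdots>x_n>\cdots$; (ii) $y_n\not\le x_n\vee\bigvee_{j<n}y_j$ for every $n\in\omega$; (iii) $y_{n+1}\le x_n$ for every $n\in\omega$.
   Context: $\mathcal{P}(\omega)$ is the set of subsets of the nonnegative integers ordered by inclusion; an order embedding $f$ satisfies $x\le y\iff f(x)\le f(y)$. For $n=0$, condition (ii) reads $y_0\not\le x_0$. -}

module Defs where

open import Data.Nat using (ℕ; _<_)
open import Data.Bool using (Bool; T)
open import Data.Product using (Σ; _×_; ∃)
open import Data.Sum using (_⊎_)
open import Relation.Nullary using (¬_)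
open import Relation.Unary using (Pred)
open import Relation.Binary.Bundles using (Poset)
open import Level using (0ℓ)

IsLub : (P : Poset 0ℓ 0ℓ 0ℓ) → Pred (Poset.Carrier P) 0ℓ → Poset.Carrier P → Set
IsLub P S s =
  (∀ t → S t → t ≤ s) × (∀ u → (∀ t → S t → t ≤ u) → s ≤ u)
  where open Poset P

record CompleteLattice : Set₁ where
  field
    poset : Poset 0ℓ 0ℓ 0ℓ
  open Poset poset public
  field
    ⋁     : Pred Carrier 0ℓ → Carrier
    ⋁-lub : ∀ S → IsLub poset S (⋁ S)

  _∨_ : Carrier → Carrier → Carrier
  a ∨ b = ⋁ (λ t → t ≈ a ⊎ t ≈ b)

  ⋁< : ℕ → (ℕ → Carrier) → Carrier
  ⋁< n y = ⋁ (λ t → ∃ λ j → j < n × t ≈ y j)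

  _<ₗ_ : Carrier → Carrier → Set
  a <ₗ b = a ≤ b × ¬ (a ≈ b)

Pω : Set
Pω = ℕ → Bool

_⊆ω_ : Pω → Pω → Set
A ⊆ω B = ∀ n → T (A n) → T (B n)

OrderEmbedding : (L : CompleteLattice) → Set
OrderEmbedding L =
  Σ (Pω → Carrier) λ f → ∀ A B → (A ⊆ω B → f A ≤ f B) × (f A ≤ f B → A ⊆ω B)
  where open CompleteLattice L

-- Given an embedding f, take xₙ = f{m | m > n} and yₙ = f{n}: then xₙ ∨ ⋁_{j<n} yⱼ lies
-- below f(ω ∖ {n}), which does not dominate f{n}. Conversely, send A ⊆ ω to ⋁_{n ∈ A} yₙ.
-- Every yₘ with m > n lies below xₙ by (iii) and (i), so if n ∉ B then ⋁_{m ∈ B} yₘ ≤ xₙ ∨ ⋁_{j<n} yⱼ,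
-- which by (ii) does not dominate yₙ; hence the map reflects the order.
module Submission where

open import Defs
open import Data.Nat using (ℕ; suc; s≤s; _≤′_; ≤′-refl; ≤′-step) renaming (_<_ to _<ℕ_)
open import Data.Nat.Properties using (_≟_; _<?_; <-cmp; <-trans; <-irrefl; ≤⇒≤′; n<1+n; <⇒≢; >⇒≢)
open import Data.Bool using (T)
open import Data.Empty using (⊥-elim)
open import Data.Product using (Σ; _×_; _,_; proj₁; proj₂; ∃)
open import Data.Sum using (inj₁; inj₂)
open import Relation.Nullary using (¬_; yes; no)
open import Relation.Nullary.Decidable using (⌊_⌋; ¬?; T?; toWitness; fromWitness)
open import Relation.Unary using (Pred; Decidable)
open import Relation.Binary.Definitions using (tri<; tri≈; tri>)
open import Relation.Binary.PropositionalEquality using (refl)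
open import Function.Bundles using (_⇔_; mk⇔)
open import Level using (0ℓ)

decSet : {P : Pred ℕ 0ℓ} → Decidable P → Pω
decSet P? m = ⌊ P? m ⌋

decSet-⊆ω : {P Q : Pred ℕ 0ℓ} (P? : Decidable P) (Q? : Decidable Q) →
            (∀ {m} → P m → Q m) → decSet P? ⊆ω decSet Q?
decSet-⊆ω P? Q? P⊆Q m m∈P = fromWitness (P⊆Q (toWitness m∈P))

module _ (L : CompleteLattice) where
  open CompleteLattice L renaming (refl to ≤-refl)

  ≤-⋁ : ∀ {S t} → S t → t ≤ ⋁ S
  ≤-⋁ {S} {t} = proj₁ (⋁-lub S) t

  ⋁-least : ∀ {S u} → (∀ {t} → S t → t ≤ u) → ⋁ S ≤ u
  ⋁-least {S} {u} bound = proj₂ (⋁-lub S) u (λ t → bound)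

  x≤x∨y : ∀ a b → a ≤ (a ∨ b)
  x≤x∨y a b = ≤-⋁ (inj₁ Eq.refl)

  y≤x∨y : ∀ a b → b ≤ (a ∨ b)
  y≤x∨y a b = ≤-⋁ (inj₂ Eq.refl)

  ∨-least : ∀ {a b c} → a ≤ c → b ≤ c → (a ∨ b) ≤ c
  ∨-least a≤c b≤c = ⋁-least λ { (inj₁ t≈a) → trans (reflexive t≈a) a≤c
                              ; (inj₂ t≈b) → trans (reflexive t≈b) b≤c }

  ≤-⋁< : ∀ {j n} (y : ℕ → Carrier) → j <ℕ n → y j ≤ ⋁< n y
  ≤-⋁< y j<n = ≤-⋁ (_ , j<n , Eq.refl)

  ⋁<-least : ∀ {n u} (y : ℕ → Carrier) → (∀ {j} → j <ℕ n → y j ≤ u) → ⋁< n y ≤ u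
  ⋁<-least y bound = ⋁-least λ { (j , j<n , t≈yj) → trans (reflexive t≈yj) (bound j<n) }

  ⋁∈ : Pω → (ℕ → Carrier) → Carrier
  ⋁∈ A y = ⋁ (λ t → ∃ λ n → T (A n) × t ≈ y n)

  ≤-⋁∈ : ∀ {A n} (y : ℕ → Carrier) → T (A n) → y n ≤ ⋁∈ A y
  ≤-⋁∈ y n∈A = ≤-⋁ (_ , n∈A , Eq.refl)

  ⋁∈-least : ∀ {A u} (y : ℕ → Carrier) → (∀ {n} → T (A n) → y n ≤ u) → ⋁∈ A y ≤ u
  ⋁∈-least y bound = ⋁-least λ { (n , n∈A , t≈yn) → trans (reflexive t≈yn) (bound n∈A) }

  ⋁∈-mono : ∀ {A B} (y : ℕ → Carrier) → A ⊆ω B → ⋁∈ A y ≤ ⋁∈ B y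
  ⋁∈-mono y A⊆B = ⋁∈-least y λ n∈A → ≤-⋁∈ y (A⊆B _ n∈A)

  antitone : ∀ (x : ℕ → Carrier) → (∀ n → x (suc n) ≤ x n) → ∀ {n m} → n ≤′ m → x m ≤ x n
  antitone x step ≤′-refl      = ≤-refl
  antitone x step (≤′-step n≤m) = trans (step _) (antitone x step n≤m)

  Separating : Set
  Separating =
    Σ (ℕ → Carrier) λ x → Σ (ℕ → Carrier) λ y →
      (∀ n → x (suc n) <ₗ x n) ×
      (∀ n → ¬ (y n ≤ (x n ∨ ⋁< n y))) ×
      (∀ n → y (suc n) ≤ x n)

  module FromEmbedding (f : Pω → Carrier)
                       (emb : ∀ A B → (A ⊆ω B → f A ≤ f B) × (f A ≤ f B → A ⊆ω B)) where

    f-mono : ∀ {A B} → A ⊆ω B → f A ≤ f B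
    f-mono = proj₁ (emb _ _)

    f-reflect : ∀ {A B} → f A ≤ f B → A ⊆ω B
    f-reflect = proj₂ (emb _ _)

    above singleton except : ℕ → Pω
    above     n = decSet (n <?_)
    singleton n = decSet (n ≟_)
    except    n = decSet (λ m → ¬? (n ≟ m))

    x y : ℕ → Carrier
    x n = f (above n)
    y n = f (singleton n)

    x-decreasing : ∀ n → x (suc n) <ₗ x n
    x-decreasing n = f-mono (decSet-⊆ω _ _ (<-trans (n<1+n n)))
                   , λ x₁+n≈xn → <-irrefl refl
                       (toWitness (f-reflect (reflexive (Eq.sym x₁+n≈xn)) (suc n) (fromWitness (n<1+n n))))

    y-separated : ∀ n → ¬ (y n ≤ (x n ∨ ⋁< n y))
    y-separated n yn≤ = toWitness (f-reflect (trans yn≤ bound) n (fromWitness refl)) refl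
      where
      bound : (x n ∨ ⋁< n y) ≤ f (except n)
      bound = ∨-least (f-mono (decSet-⊆ω _ _ <⇒≢))
                      (⋁<-least y λ j<n → f-mono (decSet-⊆ω _ _ λ { refl → >⇒≢ j<n }))

    y-below-x : ∀ n → y (suc n) ≤ x n
    y-below-x n = f-mono (decSet-⊆ω _ _ λ { refl → n<1+n n })

  embedding⇒separating : OrderEmbedding L → Separating
  embedding⇒separating (f , emb) = x , y , x-decreasing , y-separated , y-below-x
    where open FromEmbedding f emb

  module FromSeparating (x y : ℕ → Carrier) (x-decreasing : ∀ n → x (suc n) <ₗ x n)
                        (y-separated : ∀ n → ¬ (y n ≤ (x n ∨ ⋁< n y)))
                        (y-below-x : ∀ n → y (suc n) ≤ x n) where

    y-beyond-below-x : ∀ {n m} → n <ℕ m → y m ≤ x n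
    y-beyond-below-x {m = suc m} (s≤s n≤m) =
      trans (y-below-x m) (antitone x (λ k → proj₁ (x-decreasing k)) (≤⇒≤′ n≤m))

    ⋁∈-avoiding : ∀ {B n} → ¬ T (B n) → ⋁∈ B y ≤ (x n ∨ ⋁< n y)
    ⋁∈-avoiding {B} {n} n∉B = ⋁∈-least y bound
      where
      bound : ∀ {m} → T (B m) → y m ≤ (x n ∨ ⋁< n y)
      bound {m} m∈B with <-cmp m n
      ... | tri< m<n _ _ = trans (≤-⋁< y m<n) (y≤x∨y _ _)
      ... | tri≈ _ refl _ = ⊥-elim (n∉B m∈B)
      ... | tri> _ _ n<m = trans (y-beyond-below-x n<m) (x≤x∨y _ _)

    ⋁∈-reflect : ∀ {A B} → ⋁∈ A y ≤ ⋁∈ B y → A ⊆ω B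
    ⋁∈-reflect {A} {B} A≤B n n∈A with T? (B n)
    ... | yes n∈B = n∈B
    ... | no  n∉B = ⊥-elim (y-separated n (trans (≤-⋁∈ y n∈A) (trans A≤B (⋁∈-avoiding n∉B))))

  separating⇒embedding : Separating → OrderEmbedding L
  separating⇒embedding (x , y , x-decreasing , y-separated , y-below-x) =
    (λ A → ⋁∈ A y) , λ A B → ⋁∈-mono y , ⋁∈-reflect
    where open FromSeparating x y x-decreasing y-separated y-below-x

mainTheorem16 : (L : CompleteLattice) → let open CompleteLattice L in
    OrderEmbedding L ⇔
      (Σ (ℕ → Carrier) λ x → Σ (ℕ → Carrier) λ y →
        (∀ n → x (suc n) <ₗ x n) ×
        (∀ n → ¬ (y n ≤ (x n ∨ ⋁< n y))) ×
        (∀ n → y (suc n) ≤ x n))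
mainTheorem16 L = mk⇔ (embedding⇒separating L) (separating⇒embedding L)
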